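{- Let $A$ be a set with relations $<, \leq\, : A \to A \to \mathsf{hProp}$ satisfying: (A1) $<$ is transitive and irreflexive; (A2) $\leq$ is reflexive, transitive and antisymmetric; (A3) for all $a,b,c$, $b < a \to b \leq a$, and $c < b \to b \leq a \to c < a$. Then for every $a : A$, the type $\mathsf{is\text{ - }zero}(a) \uplus \mathsf{is\text{ - }str\text{ - }suc}(a) \uplus \mathsf{is\text{ - }limit}(a)$ is a proposition; i.e.\ $a$ is at most one of zero, strong successor, limit, and in a unique way.
   Context: Work in homotopy type theory; $\mathsf{hProp}$ is the type of propositions, $\exists$ denotes the propositional truncation of a $\Sigma$-type. Definitions for $(A,<,\leq)$: $\mathsf{is\text{ - }zero}(a) := \forall b.\, a \leq b$. $a \text{ is-suc-of } b := (b < a) \times \forall x.\,(b < x \to a \leq x)$. $a \text{ is-str-suc-of } b := (a \text{ is-suc-of } b) \times \forall x.\,(x < a \to x \leq b)$. $\mathsf{is\text{ - }str\text{ - }suc}(a) := \Sigma(b:A).\, a \text{ is-str-suc-of } b$. For $f : \mathbb{N} \to A$, $a \text{ is-sup-of } f := (\forall i. f(i) \leq a) \times \forall x.\,((\forall i. f(i) \leq x) \to a \leq x)$. A sequence is increasing if $\forall k. f(k) < f(k+1)$; $\mathbb{N} \to_{<} A$ is the type of increasing sequences. $\mathsf{is\text{ - }limit}(a) := \exists(f : \mathbb{N} \to_{<} A).\, a \text{ is-sup-of } f$. -}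

module Defs where

open import Level using (Level; _⊔_; Setω)
open import Data.Nat using (ℕ; suc)
open import Data.Product using (Σ; _×_)
open import Relation.Binary.PropositionalEquality using (_≡_)
open import Relation.Nullary using (¬_)

isProp : ∀ {ℓ} → Set ℓ → Set ℓ
isProp X = (x y : X) → x ≡ y

isSet : ∀ {ℓ} → Set ℓ → Set ℓ
isSet X = (x y : X) → isProp (x ≡ y)

record PropTrunc : Setω where
  field
    ∥_∥    : ∀ {ℓ} → Set ℓ → Set ℓ
    ∣_∣    : ∀ {ℓ} {X : Set ℓ} → X → ∥ X ∥
    squash : ∀ {ℓ} {X : Set ℓ} → isProp ∥ X ∥
    rec    : ∀ {ℓ ℓ'} {X : Set ℓ} {P : Set ℓ'} → isProp P → (X → P) → ∥ X ∥ → P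

∃ₜ : ∀ {a b} (T : PropTrunc) (X : Set a) → (X → Set b) → Set (a ⊔ b)
∃ₜ T X P = PropTrunc.∥_∥ T (Σ X P)

module _ {a r : Level} {A : Set a} (_<_ _≤_ : A → A → Set r) where

  is-zero : A → Set (a ⊔ r)
  is-zero x = ∀ y → x ≤ y

  is-suc-of : A → A → Set (a ⊔ r)
  is-suc-of x y = (y < x) × (∀ z → y < z → x ≤ z)

  is-str-suc-of : A → A → Set (a ⊔ r)
  is-str-suc-of x y = is-suc-of x y × (∀ z → z < x → z ≤ y)

  is-str-suc : A → Set (a ⊔ r)
  is-str-suc x = Σ A (λ y → is-str-suc-of x y)

  is-sup-of : A → (ℕ → A) → Set (a ⊔ r)
  is-sup-of x f = (∀ i → f i ≤ x) × (∀ z → (∀ i → f i ≤ z) → x ≤ z)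

  is-increasing : (ℕ → A) → Set r
  is-increasing f = ∀ k → f k < f (suc k)

  IncSeq : Set (a ⊔ r)
  IncSeq = Σ (ℕ → A) is-increasing

  is-limit : PropTrunc → A → Set (a ⊔ r)
  is-limit T x = ∃ₜ T IncSeq (λ f → is-sup-of x (Σ.proj₁ f))

{-# OPTIONS --safe #-}
-- A zero lies below everything while both a strong successor x of y and a
-- limit x of an increasing sequence have something strictly below them, so
-- a zero is neither. A limit x of f is not a strong successor of y either:
-- every f i lies strictly below f (suc i) ≤ x, hence below y, so x ≤ y < x.
-- Each summand is a proposition; for strong successors this is because the
-- predecessor y is determined by x, being the greatest element below x.
module Submission where

open import Defs
open import Level using (Level)
open import Data.Sum using (_⊎_; inj₁; inj₂)
open import Data.Product using (Σ; _×_; _,_; proj₁)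
open import Data.Nat using (suc)
open import Data.Empty using (⊥)
open import Relation.Nullary using (¬_; contradiction)
open import Relation.Binary.PropositionalEquality using (_≡_; refl; cong; cong₂)
open import Axiom.Extensionality.Propositional using (Extensionality)

isProp-⊥ : isProp ⊥
isProp-⊥ ()

isProp-× : ∀ {a b} {X : Set a} {Y : Set b} → isProp X → isProp Y → isProp (X × Y)
isProp-× pX pY (x , y) (x′ , y′) = cong₂ _,_ (pX x x′) (pY y y′)

isProp-Π : ∀ {a b} → Extensionality a b → {X : Set a} {Y : X → Set b} →
           (∀ x → isProp (Y x)) → isProp ((x : X) → Y x)
isProp-Π funext pY f g = funext λ x → pY x (f x) (g x)

isProp-Σ : ∀ {a b} {X : Set a} {Y : X → Set b} → (∀ x → isProp (Y x)) →
           ((u v : Σ X Y) → proj₁ u ≡ proj₁ v) → isProp (Σ X Y)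
isProp-Σ pY proj₁-unique u@(x , y) v@(_ , y′) with proj₁-unique u v
... | refl = cong (x ,_) (pY x y y′)

isProp-⊎ : ∀ {a b} {X : Set a} {Y : Set b} → isProp X → isProp Y →
           (X → ¬ Y) → isProp (X ⊎ Y)
isProp-⊎ pX pY disjoint (inj₁ x) (inj₁ x′) = cong inj₁ (pX x x′)
isProp-⊎ pX pY disjoint (inj₁ x) (inj₂ y)  = contradiction y (disjoint x)
isProp-⊎ pX pY disjoint (inj₂ y) (inj₁ x)  = contradiction y (disjoint x)
isProp-⊎ pX pY disjoint (inj₂ y) (inj₂ y′) = cong inj₂ (pY y y′)

module _ {a r : Level} {A : Set a} {_<_ _≤_ : A → A → Set r} where

  str-pred-unique : (∀ x y → x ≤ y → y ≤ x → x ≡ y) →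
                    ∀ {x y y′} → is-str-suc-of _<_ _≤_ x y → is-str-suc-of _<_ _≤_ x y′ → y ≡ y′
  str-pred-unique antisym {y = y} {y′} ((y<x , _) , below-x≤y) ((y′<x , _) , below-x≤y′) =
    antisym y y′ (below-x≤y′ y y<x) (below-x≤y y′ y′<x)

  module _ (funext : ∀ {ℓ ℓ′} → Extensionality ℓ ℓ′)
           (≤-isProp : ∀ x y → isProp (x ≤ y)) where

    is-zero-isProp : ∀ x → isProp (is-zero _<_ _≤_ x)
    is-zero-isProp x = isProp-Π funext (≤-isProp x)

    module _ (<-isProp : ∀ x y → isProp (x < y)) where

      is-str-suc-of-isProp : ∀ x y → isProp (is-str-suc-of _<_ _≤_ x y)
      is-str-suc-of-isProp x y =
        isProp-× (isProp-× (<-isProp y x) (isProp-Π funext λ z → isProp-Π funext λ _ → ≤-isProp x z))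
                 (isProp-Π funext λ z → isProp-Π funext λ _ → ≤-isProp z y)

      is-str-suc-isProp : (∀ x y → x ≤ y → y ≤ x → x ≡ y) → ∀ x → isProp (is-str-suc _<_ _≤_ x)
      is-str-suc-isProp antisym x =
        isProp-Σ (is-str-suc-of-isProp x) λ (_ , x-suc) (_ , x-suc′) → str-pred-unique antisym x-suc x-suc′

  module _ (<-irrefl : ∀ x → ¬ (x < x))
           (<-≤-trans : ∀ {x y z} → x < y → y ≤ z → x < z) where

    zero-not-str-suc : ∀ {x} → is-zero _<_ _≤_ x → ¬ is-str-suc _<_ _≤_ x
    zero-not-str-suc x≤ (y , (y<x , _) , _) = <-irrefl y (<-≤-trans y<x (x≤ y))

    sup-not-str-suc : ∀ {x} (f : IncSeq _<_ _≤_) → is-sup-of _<_ _≤_ x (proj₁ f) →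
                      ¬ is-str-suc _<_ _≤_ x
    sup-not-str-suc (f , f-inc) (f≤x , x-least) (y , (y<x , _) , below-x≤y) =
      <-irrefl y (<-≤-trans y<x (x-least y λ i → below-x≤y (f i) (<-≤-trans (f-inc i) (f≤x (suc i)))))

    limit-not-str-suc : (T : PropTrunc) → ∀ {x} → is-limit _<_ _≤_ T x → ¬ is-str-suc _<_ _≤_ x
    limit-not-str-suc T x-lim x-suc =
      PropTrunc.rec T isProp-⊥ (λ (f , x-sup) → sup-not-str-suc f x-sup x-suc) x-lim

    module _ (≤-trans : ∀ {x y z} → x ≤ y → y ≤ z → x ≤ z) where

      sup-not-zero : ∀ {x} (f : IncSeq _<_ _≤_) → is-sup-of _<_ _≤_ x (proj₁ f) →
                     ¬ is-zero _<_ _≤_ x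
      sup-not-zero (f , f-inc) (f≤x , _) x≤ =
        <-irrefl (f 0) (<-≤-trans (f-inc 0) (≤-trans (f≤x 1) (x≤ (f 0))))

      limit-not-zero : (T : PropTrunc) → ∀ {x} → is-limit _<_ _≤_ T x → ¬ is-zero _<_ _≤_ x
      limit-not-zero T x-lim x≤ = PropTrunc.rec T isProp-⊥ (λ (f , x-sup) → sup-not-zero f x-sup x≤) x-lim

theorem4p9 : {a r : Level}
    → (funext : ∀ {ℓ ℓ'} → Extensionality ℓ ℓ')
    → (T : PropTrunc)
    → (A : Set a) → isSet A
    → (_<_ _≤_ : A → A → Set r)
    → (∀ x y → isProp (x < y))
    → (∀ x y → isProp (x ≤ y))
    → (∀ x y z → x < y → y < z → x < z)
    → (∀ x → ¬ (x < x))
    → (∀ x → x ≤ x)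
    → (∀ x y z → x ≤ y → y ≤ z → x ≤ z)
    → (∀ x y → x ≤ y → y ≤ x → x ≡ y)
    → (∀ x y → y < x → y ≤ x)
    → (∀ x y z → z < y → y ≤ x → z < x)
    → (x : A) → isProp (is-zero _<_ _≤_ x ⊎ (is-str-suc _<_ _≤_ x ⊎ is-limit _<_ _≤_ T x))
theorem4p9 funext T A _ _<_ _≤_ <-isProp ≤-isProp _ <-irrefl _ ≤-trans antisym _ <-≤-trans x =
  isProp-⊎ (is-zero-isProp {_<_ = _<_} funext ≤-isProp x)
           (isProp-⊎ (is-str-suc-isProp funext ≤-isProp <-isProp antisym x) (PropTrunc.squash T)
                     λ x-suc x-lim → limit-not-str-suc <-irrefl <-≤-trans′ T x-lim x-suc)
           λ { x-zero (inj₁ x-suc) → zero-not-str-suc <-irrefl <-≤-trans′ x-zero x-suc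
             ; x-zero (inj₂ x-lim) → limit-not-zero <-irrefl <-≤-trans′ ≤-trans′ T x-lim x-zero }
  where
  <-≤-trans′ : ∀ {x y z} → x < y → y ≤ z → x < z
  <-≤-trans′ x<y y≤z = <-≤-trans _ _ _ x<y y≤z
  ≤-trans′ : ∀ {x y z} → x ≤ y → y ≤ z → x ≤ z
  ≤-trans′ = ≤-trans _ _ _
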